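{- Let $m\ge 3$ and $n\ge 2$. For every positive integer $k$, $$\chi^b_{B_1(m,n)}(2k)=\Big[\sum_{i=0}^{m-2}(-1)^i(2k-1)^{(m-2)-i}\Big]\,\chi^b_{B_1(m,n-1)}(2k).$$
   Context: A signed graph $(G,\sigma)$ is a finite graph $G$ with a sign function $\sigma:E(G)\to\{+1,-1\}$; its signature is the set of negative edges. A zero-free signed coloring in $2k$ colors is a map $c:V(G)\to\{ -k,\dots,-1,1,\dots,k\}$; it is proper if $c(y)\neq\sigma(e)c(x)$ for every edge $e=xy$. The balanced chromatic polynomial $\chi^b_{(G,\sigma)}(2k)$ is the number of proper zero-free signed colorings in $2k$ colors. For integers $m\ge 3$, $n\ge 1$, the Book graph $B(m,n)$ has vertex set $\{u,v\}\cup\{u_j^l:1\le l\le n,\,1\le j\le m-2\}$ and consists of the $n$ cycles $u\,u_1^l\cdots u_{m-2}^l\,v\,u$ sharing the edge $uv$. For $1\le l\le n$, $B_l(m,n)$ denotes $B(m,n)$ with signature $\{uu_1^1,\dots,uu_1^l\}$. -}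

module Defs where

open import Data.Nat as ℕ using (ℕ; zero; suc; _∸_; _<ᵇ_)
open import Data.Integer as ℤ using (ℤ; +_; -_; _*_; _-_)
open import Data.Fin using (Fin; zero; suc; _↑ʳ_; combine; toℕ)
open import Data.Vec using (Vec; []; _∷_; lookup)
open import Data.List as List using (List; []; _∷_; _++_; map; concatMap; upTo; length; filter; allFin)
open import Data.List.Relation.Unary.All as All using (All)
open import Data.Product using (_×_; _,_)
open import Data.Bool using (Bool; true; false; if_then_else_)
open import Relation.Nullary using (¬_; Dec; ¬?)
open import Relation.Binary.PropositionalEquality using (_≡_)

data Sign : Set where
  pos neg : Sign

⟦_⟧ : Sign → ℤ
⟦ pos ⟧ = + 1
⟦ neg ⟧ = - (+ 1)

record SignedGraph : Set where
  field
    order : ℕ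
    edges : List (Fin order × Fin order × Sign)
open SignedGraph public

-- The 2k zero-free signed colors {-k,…,-1,1,…,k}.
posColors : ℕ → List ℤ
posColors k = map (λ i → + suc i) (upTo k)

colors : ℕ → List ℤ
colors k = map -_ (posColors k) ++ posColors k

allVecs : List ℤ → (N : ℕ) → List (Vec ℤ N)
allVecs cs zero = [] ∷ []
allVecs cs (suc N) = concatMap (λ a → map (a ∷_) (allVecs cs N)) cs

ProperEdge : ∀ {N} → Vec ℤ N → Fin N × Fin N × Sign → Set
ProperEdge c (x , y , s) = ¬ (lookup c y ≡ ⟦ s ⟧ * lookup c x)

Proper : (G : SignedGraph) → Vec ℤ (order G) → Set
Proper G c = All (ProperEdge c) (edges G)

proper? : (G : SignedGraph) → (c : Vec ℤ (order G)) → Dec (Proper G c)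
proper? G c = All.all? (λ { (x , y , s) → ¬? (lookup c y ℤ.≟ ⟦ s ⟧ * lookup c x) }) (edges G)

-- Balanced chromatic polynomial evaluated at 2k: number of proper
-- zero-free signed colorings in 2k colors.
χb : SignedGraph → ℕ → ℕ
χb G k = length (filter (proper? G) (allVecs (colors k) (order G)))

pairs : ∀ {A : Set} → List A → List (A × A)
pairs (a ∷ b ∷ xs) = (a , b) ∷ pairs (b ∷ xs)
pairs _ = []

-- Book graph B(m,n) with signature {u u_1^1, …, u u_1^t}.
-- Vertices: u = 0, v = 1, u_j^l = 2 + (l-1)(m-2) + (j-1)  (l ∈ Fin n, j ∈ Fin (m-2)).
module _ (t m n : ℕ) where
  private
    p = m ∸ 2
    N = 2 ℕ.+ n ℕ.* p
    U V : Fin N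
    U = zero
    V = suc zero
    inner : Fin n → Fin p → Fin N
    inner l j = 2 ↑ʳ combine l j
    page : Fin n → List (Fin N)
    page l = U ∷ map (inner l) (allFin p) ++ V ∷ []
    -- first edge u u_1^l is negative iff l < t (i.e. l+1 ≤ t)
    signPage : Fin n → List (Fin N × Fin N × Sign)
    signPage l with pairs (page l)
    ... | [] = []
    ... | (x , y) ∷ rest =
          (x , y , (if toℕ l <ᵇ t then neg else pos)) ∷ map (λ { (a , b) → (a , b , pos) }) rest

  Book : SignedGraph
  Book = record
    { order = N
    ; edges = (U , V , pos) ∷ concatMap signPage (allFin n) }

bookFactor : ℕ → ℕ → ℤ
bookFactor m k =
  List.foldr ℤ._+_ (+ 0)
    (map (λ i → ((- (+ 1)) ℤ.^ i) * ((+ (2 ℕ.* k) - + 1) ℤ.^ ((m ∸ 2) ∸ i))) (upTo (suc (m ∸ 2))))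

module Submission where

-- Write m = m' + 3, so every page of the book has p = m' + 1 inner vertices.
-- Fix the colours a, b of the spine u v (a ≠ b, since uv is positive).  A page
-- whose first edge u u₁ has sign σ is then properly coloured exactly when its
-- inner colours x₁ … x_p form a walk σa, x₁, …, x_p, b with no two consecutive
-- entries equal; the pages are independent, so the number of proper colourings
-- factorises as a product over pages (Book-proper⇔, χb-Book, PageCount).
-- For a positive page this is a walk between the distinct colours a and b in
-- the complete graph on the 2k colours, whose number walks≢ q p (q + 2 = 2k)
-- does not depend on a, b (CompleteGraphWalks) and equals the alternating sum
-- of powers of q + 1 = 2k - 1 (walks≢-closedForm).  In B₁ only page 0 is
-- negative, so χᵇ(B₁(m, n + 1)) = (spine count) · (walks≢ q p)^n, from which
-- the recurrence follows.

module BookColourings where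
  open import Defs
  open import Data.Nat using (ℕ; zero; suc; _+_; _*_; _^_; _∸_; _<ᵇ_)
  open import Data.Nat.Properties
    using (+-assoc; +-comm; +-identityʳ; +-suc; *-zeroʳ; *-comm; *-assoc; *-distribˡ-+;
           +-cancelˡ-≡; +-cancelʳ-≡; m+n∸n≡m; m≤n+m; suc-injective)
  open import Data.Nat.Tactic.RingSolver using (solve-∀)
  open import Data.Integer as ℤ using (ℤ)
  import Data.Integer.Properties as ℤP
  open import Data.Fin using (Fin; zero; suc; toℕ; combine; _↑ʳ_)
  import Data.Fin.Properties as FinP
  open import Data.Vec as Vec using (Vec; []; _∷_; lookup)
  import Data.Vec.Properties as VecP
  open import Data.List as List
    using (List; []; _∷_; _++_; map; concatMap; allFin; tabulate; filter; length; foldr; upTo; applyUpTo)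
  import Data.List.Properties as ListP
  open import Data.List.Relation.Unary.All as All using (All; []; _∷_)
  import Data.List.Relation.Unary.All.Properties as AllP
  open import Data.List.Relation.Unary.Any using (here; there)
  open import Data.List.Relation.Unary.AllPairs using (_∷_)
  open import Data.List.Relation.Unary.Unique.Propositional using (Unique)
  import Data.List.Relation.Unary.Unique.Propositional.Properties as UniqueP
  open import Data.List.Membership.Propositional using (_∈_)
  open import Data.List.Membership.Propositional.Properties using (∈-map⁻)
  open import Data.Product using (_×_; _,_; proj₁; proj₂)
  open import Data.Bool using (if_then_else_)
  open import Data.Empty using (⊥; ⊥-elim)
  open import Function.Bundles using (_⇔_; mk⇔; Equivalence)
  open import Relation.Nullary using (¬_; Dec; yes; no; ¬?)
  open import Relation.Nullary.Decidable using (_×-dec_)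
  open import Relation.Binary.Definitions using (DecidableEquality)
  open import Relation.Binary.PropositionalEquality

  open Equivalence using (to; from)

  ∑ : {A : Set} → List A → (A → ℕ) → ℕ
  ∑ []       f = 0
  ∑ (x ∷ xs) f = f x + ∑ xs f

  infix 5 ∑
  syntax ∑ xs (λ x → e) = ∑[ x ← xs ] e

  ∑-cong∈ : {A : Set} {f g : A → ℕ} (xs : List A) →
            (∀ x → x ∈ xs → f x ≡ g x) → ∑ xs f ≡ ∑ xs g
  ∑-cong∈ []       f≗g = refl
  ∑-cong∈ (x ∷ xs) f≗g = cong₂ _+_ (f≗g x (here refl)) (∑-cong∈ xs (λ y y∈xs → f≗g y (there y∈xs)))

  ∑-cong : {A : Set} {f g : A → ℕ} (xs : List A) → (∀ x → f x ≡ g x) → ∑ xs f ≡ ∑ xs g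
  ∑-cong xs f≗g = ∑-cong∈ xs (λ x _ → f≗g x)

  ∑-++ : {A : Set} (f : A → ℕ) (xs ys : List A) → ∑ (xs ++ ys) f ≡ ∑ xs f + ∑ ys f
  ∑-++ f []       ys = refl
  ∑-++ f (x ∷ xs) ys = trans (cong (f x +_) (∑-++ f xs ys)) (sym (+-assoc (f x) _ _))

  ∑-map : {A B : Set} (f : B → ℕ) (g : A → B) (xs : List A) → ∑ (map g xs) f ≡ ∑[ x ← xs ] f (g x)
  ∑-map f g []       = refl
  ∑-map f g (x ∷ xs) = cong (f (g x) +_) (∑-map f g xs)

  ∑-concatMap : {A B : Set} (f : B → ℕ) (g : A → List B) (xs : List A) →
                ∑ (concatMap g xs) f ≡ ∑[ x ← xs ] ∑ (g x) f
  ∑-concatMap f g []       = refl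
  ∑-concatMap f g (x ∷ xs) = trans (∑-++ f (g x) _) (cong (∑ (g x) f +_) (∑-concatMap f g xs))

  ∑-*ˡ : {A : Set} (c : ℕ) (f : A → ℕ) (xs : List A) → ∑[ x ← xs ] (c * f x) ≡ c * ∑ xs f
  ∑-*ˡ c f []       = sym (*-zeroʳ c)
  ∑-*ˡ c f (x ∷ xs) = trans (cong (c * f x +_) (∑-*ˡ c f xs)) (sym (*-distribˡ-+ c (f x) _))

  ∑-*ʳ : {A : Set} (c : ℕ) (f : A → ℕ) (xs : List A) → ∑[ x ← xs ] (f x * c) ≡ ∑ xs f * c
  ∑-*ʳ c f xs = trans (∑-cong xs (λ x → *-comm (f x) c)) (trans (∑-*ˡ c f xs) (*-comm c _))

  ∑-const : {A : Set} (c : ℕ) (xs : List A) → ∑[ x ← xs ] c ≡ length xs * c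
  ∑-const c []       = refl
  ∑-const c (x ∷ xs) = cong (c +_) (∑-const c xs)

  𝟙 : {P : Set} → Dec P → ℕ
  𝟙 (yes _) = 1
  𝟙 (no _)  = 0

  𝟙-⇔ : {P Q : Set} → P ⇔ Q → (p : Dec P) (q : Dec Q) → 𝟙 p ≡ 𝟙 q
  𝟙-⇔ P⇔Q (yes _) (yes _) = refl
  𝟙-⇔ P⇔Q (yes p) (no ¬q) = ⊥-elim (¬q (to P⇔Q p))
  𝟙-⇔ P⇔Q (no ¬p) (yes q) = ⊥-elim (¬p (from P⇔Q q))
  𝟙-⇔ P⇔Q (no _)  (no _)  = refl

  𝟙-× : {P Q : Set} (p : Dec P) (q : Dec Q) → 𝟙 (p ×-dec q) ≡ 𝟙 p * 𝟙 q
  𝟙-× (yes _) (yes _) = refl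
  𝟙-× (yes _) (no _)  = refl
  𝟙-× (no _)  q       = refl

  length-filter : {A : Set} {P : A → Set} (P? : ∀ x → Dec (P x)) (xs : List A) →
                  length (filter P? xs) ≡ ∑[ x ← xs ] 𝟙 (P? x)
  length-filter P? []       = refl
  length-filter P? (x ∷ xs) with P? x
  ... | yes _ = cong suc (length-filter P? xs)
  ... | no _  = length-filter P? xs

  ∑-allVecs-suc : (cs : List ℤ) (N : ℕ) (h : Vec ℤ (suc N) → ℕ) →
                  ∑ (allVecs cs (suc N)) h ≡ ∑[ a ← cs ] ∑[ v ← allVecs cs N ] h (a ∷ v)
  ∑-allVecs-suc cs N h =
    trans (∑-concatMap h _ cs) (∑-cong cs (λ a → ∑-map h (a ∷_) (allVecs cs N)))

  ∑-allVecs-++ : (cs : List ℤ) (M N : ℕ) (h : Vec ℤ (M + N) → ℕ) →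
                 ∑ (allVecs cs (M + N)) h ≡ ∑[ v ← allVecs cs M ] ∑[ w ← allVecs cs N ] h (v Vec.++ w)
  ∑-allVecs-++ cs zero    N h = sym (+-identityʳ _)
  ∑-allVecs-++ cs (suc M) N h = begin
      ∑ (allVecs cs (suc M + N)) h
    ≡⟨ ∑-allVecs-suc cs (M + N) h ⟩
      ∑[ a ← cs ] ∑[ u ← allVecs cs (M + N) ] h (a ∷ u)
    ≡⟨ ∑-cong cs (λ a → ∑-allVecs-++ cs M N (λ u → h (a ∷ u))) ⟩
      ∑[ a ← cs ] ∑[ v ← allVecs cs M ] ∑[ w ← allVecs cs N ] h (a ∷ v Vec.++ w)
    ≡⟨ ∑-allVecs-suc cs M (λ v → ∑[ w ← allVecs cs N ] h (v Vec.++ w)) ⟨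
      ∑[ v ← allVecs cs (suc M) ] ∑[ w ← allVecs cs N ] h (v Vec.++ w)
    ∎
    where open ≡-Reasoning

  module _ {A : Set} (_≟_ : DecidableEquality A) where

    ∑-avoiding : (h : A → ℕ) (a : A) (xs : List A) → All (λ x → ¬ x ≡ a) xs →
                 ∑[ x ← xs ] 𝟙 (¬? (x ≟ a)) * h x ≡ ∑ xs h
    ∑-avoiding h a []       []          = refl
    ∑-avoiding h a (x ∷ xs) (x≢a ∷ ≢a) with x ≟ a
    ... | yes x≡a = ⊥-elim (x≢a x≡a)
    ... | no _    = cong₂ _+_ (+-identityʳ (h x)) (∑-avoiding h a xs ≢a)

    ∑-split : (h : A → ℕ) {a : A} (xs : List A) → Unique xs → a ∈ xs →
              ∑ xs h ≡ h a + (∑[ x ← xs ] 𝟙 (¬? (x ≟ a)) * h x)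
    ∑-split h (y ∷ ys) (y≢ys ∷ _) (here refl) with y ≟ y
    ... | yes _  = cong (h y +_) (sym (∑-avoiding h y ys (All.map (λ y≢x x≡y → y≢x (sym x≡y)) y≢ys)))
    ... | no y≢y = ⊥-elim (y≢y refl)
    ∑-split h {a} (y ∷ ys) (y≢ys ∷ ys-unique) (there a∈ys) with y ≟ a
    ... | yes refl = ⊥-elim (All.lookup y≢ys a∈ys refl)
    ... | no _     = begin
        h y + ∑ ys h
      ≡⟨ cong (h y +_) (∑-split h ys ys-unique a∈ys) ⟩
        h y + (h a + rest)
      ≡⟨ shuffle (h y) (h a) rest ⟩
        h a + (h y + 0 + rest)
      ∎
      where
      open ≡-Reasoning
      rest : ℕ
      rest = ∑[ x ← ys ] 𝟙 (¬? (x ≟ a)) * h x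
      shuffle : ∀ u v w → u + (v + w) ≡ v + (u + 0 + w)
      shuffle = solve-∀

  -- Walk a xs b: in the sequence a, x₁, …, xₙ, b no two consecutive entries are
  -- equal, i.e. it is a proper colouring of a path whose edges are all positive.
  Walk : ℤ → List ℤ → ℤ → Set
  Walk a []       b = ¬ b ≡ a
  Walk a (x ∷ xs) b = ¬ x ≡ a × Walk x xs b

  walk? : ∀ a xs b → Dec (Walk a xs b)
  walk? a []       b = ¬? (b ℤ.≟ a)
  walk? a (x ∷ xs) b = ¬? (x ℤ.≟ a) ×-dec walk? x xs b

  walkCount : List ℤ → ℕ → ℤ → ℤ → ℕ
  walkCount cs n a b = ∑[ v ← allVecs cs n ] 𝟙 (walk? a (tabulate (lookup v)) b)

  walkCount-suc : (cs : List ℤ) (n : ℕ) (a b : ℤ) →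
                  walkCount cs (suc n) a b ≡ ∑[ x ← cs ] 𝟙 (¬? (x ℤ.≟ a)) * walkCount cs n x b
  walkCount-suc cs n a b = trans (∑-allVecs-suc cs n _) (∑-cong cs λ x →
    trans (∑-cong (allVecs cs n) (λ v → 𝟙-× (¬? (x ℤ.≟ a)) (walk? x (tabulate (lookup v)) b)))
          (∑-*ˡ (𝟙 (¬? (x ℤ.≟ a))) _ (allVecs cs n)))

  -- Walks in the complete graph on q + 2 vertices: walks≢ q n counts the
  -- walks with n inner vertices between two fixed distinct vertices, walks≡ q n
  -- those from a fixed vertex back to itself.
  walks≢ walks≡ : ℕ → ℕ → ℕ
  walks≢ q zero    = 1
  walks≢ q (suc n) = q * walks≢ q n + walks≡ q n
  walks≡ q zero    = 0
  walks≡ q (suc n) = suc q * walks≢ q n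

  -- Rearranging the defining recursion; with walks-total it gives
  -- walks≢ q (n + 1) + walks≢ q n = (q + 1)^(n + 1).
  walks≢-recurrence : ∀ q n → walks≢ q (suc n) + walks≢ q n ≡ walks≡ q n + suc q * walks≢ q n
  walks≢-recurrence q n = shuffle q (walks≢ q n) (walks≡ q n)
    where
    shuffle : ∀ q d e → (q * d + e) + d ≡ e + (d + q * d)
    shuffle = solve-∀

  -- Walks from a fixed vertex with n inner vertices and an arbitrary end
  -- vertex: there are (q + 1)^(n + 1) of them.
  walks-total : ∀ q n → walks≡ q n + suc q * walks≢ q n ≡ suc q ^ suc n
  walks-total q zero    = refl
  walks-total q (suc n) = trans (regroup q (walks≢ q n) (walks≡ q n)) (cong (suc q *_) (walks-total q n))
    where
    regroup : ∀ q d e → suc q * d + suc q * (q * d + e) ≡ suc q * (e + suc q * d)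
    regroup = solve-∀

  module CompleteGraphWalks (cs : List ℤ) (q : ℕ) (cs-unique : Unique cs)
                            (cs-length : length cs ≡ suc (suc q)) where

    WalkCounts : ℕ → Set
    WalkCounts n = (∀ {a b} → a ∈ cs → b ∈ cs → ¬ a ≡ b → walkCount cs n a b ≡ walks≢ q n)
                 × (∀ {a} → a ∈ cs → walkCount cs n a a ≡ walks≡ q n)

    ∑-others : ∀ {b} → b ∈ cs → (c : ℕ) → ∑[ x ← cs ] 𝟙 (¬? (x ℤ.≟ b)) * c ≡ suc q * c
    ∑-others b∈cs c = +-cancelˡ-≡ c _ _ (begin
        c + (∑[ x ← cs ] 𝟙 (¬? (x ℤ.≟ _)) * c)
      ≡⟨ ∑-split ℤ._≟_ (λ _ → c) cs cs-unique b∈cs ⟨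
        ∑[ x ← cs ] c
      ≡⟨ ∑-const c cs ⟩
        length cs * c
      ≡⟨ cong (_* c) cs-length ⟩
        c + suc q * c
      ∎)
      where open ≡-Reasoning

    ∑-walkCount : ∀ {n b} → WalkCounts n → b ∈ cs →
                  ∑[ x ← cs ] walkCount cs n x b ≡ walks≡ q n + suc q * walks≢ q n
    ∑-walkCount {n} {b} (counts≢ , counts≡) b∈cs = begin
        ∑ cs into-b
      ≡⟨ ∑-split ℤ._≟_ into-b cs cs-unique b∈cs ⟩
        into-b b + (∑[ x ← cs ] 𝟙 (¬? (x ℤ.≟ b)) * into-b x)
      ≡⟨ cong₂ _+_ (counts≡ b∈cs) (∑-cong∈ cs from-others) ⟩
        walks≡ q n + (∑[ x ← cs ] 𝟙 (¬? (x ℤ.≟ b)) * walks≢ q n)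
      ≡⟨ cong (walks≡ q n +_) (∑-others b∈cs (walks≢ q n)) ⟩
        walks≡ q n + suc q * walks≢ q n
      ∎
      where
      open ≡-Reasoning
      into-b : ℤ → ℕ
      into-b x = walkCount cs n x b
      from-others : ∀ x → x ∈ cs → 𝟙 (¬? (x ℤ.≟ b)) * into-b x ≡ 𝟙 (¬? (x ℤ.≟ b)) * walks≢ q n
      from-others x x∈cs with x ℤ.≟ b
      ... | yes _   = refl
      ... | no x≢b  = cong (_+ 0) (counts≢ x∈cs b∈cs x≢b)

    -- Walks from a with n + 1 inner vertices plus those with n inner vertices
    -- together are all walks into b, split according to whether they start at a.
    walkCount-step : ∀ {n a b} → WalkCounts n → a ∈ cs → b ∈ cs →
                     walkCount cs (suc n) a b + walkCount cs n a b ≡ walks≡ q n + suc q * walks≢ q n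
    walkCount-step {n} {a} {b} counts a∈cs b∈cs = begin
        walkCount cs (suc n) a b + walkCount cs n a b
      ≡⟨ cong (_+ walkCount cs n a b) (walkCount-suc cs n a b) ⟩
        (∑[ x ← cs ] 𝟙 (¬? (x ℤ.≟ a)) * walkCount cs n x b) + walkCount cs n a b
      ≡⟨ +-comm _ (walkCount cs n a b) ⟩
        walkCount cs n a b + (∑[ x ← cs ] 𝟙 (¬? (x ℤ.≟ a)) * walkCount cs n x b)
      ≡⟨ ∑-split ℤ._≟_ (λ x → walkCount cs n x b) cs cs-unique a∈cs ⟨
        ∑[ x ← cs ] walkCount cs n x b
      ≡⟨ ∑-walkCount {n} counts b∈cs ⟩
        walks≡ q n + suc q * walks≢ q n
      ∎
      where open ≡-Reasoning

    walkCounts : ∀ n → WalkCounts n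
    walkCounts zero = distinct , equal
      where
      distinct : ∀ {a b} → a ∈ cs → b ∈ cs → ¬ a ≡ b → walkCount cs zero a b ≡ 1
      distinct {a} {b} _ _ a≢b with b ℤ.≟ a
      ... | yes b≡a = ⊥-elim (a≢b (sym b≡a))
      ... | no _    = refl
      equal : ∀ {a} → a ∈ cs → walkCount cs zero a a ≡ 0
      equal {a} _ with a ℤ.≟ a
      ... | yes _   = refl
      ... | no a≢a  = ⊥-elim (a≢a refl)
    walkCounts (suc n) = distinct , equal
      where
      open ≡-Reasoning
      counts : WalkCounts n
      counts = walkCounts n
      distinct : ∀ {a b} → a ∈ cs → b ∈ cs → ¬ a ≡ b → walkCount cs (suc n) a b ≡ walks≢ q (suc n)
      distinct {a} {b} a∈cs b∈cs a≢b = +-cancelʳ-≡ (walks≢ q n) _ _ (begin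
          walkCount cs (suc n) a b + walks≢ q n
        ≡⟨ cong (walkCount cs (suc n) a b +_) (proj₁ counts a∈cs b∈cs a≢b) ⟨
          walkCount cs (suc n) a b + walkCount cs n a b
        ≡⟨ walkCount-step counts a∈cs b∈cs ⟩
          walks≡ q n + suc q * walks≢ q n
        ≡⟨ walks≢-recurrence q n ⟨
          walks≢ q (suc n) + walks≢ q n
        ∎)
      equal : ∀ {a} → a ∈ cs → walkCount cs (suc n) a a ≡ walks≡ q (suc n)
      equal {a} a∈cs = +-cancelˡ-≡ (walks≡ q n) _ _ (begin
          walks≡ q n + walkCount cs (suc n) a a
        ≡⟨ +-comm (walks≡ q n) _ ⟩
          walkCount cs (suc n) a a + walks≡ q n
        ≡⟨ cong (walkCount cs (suc n) a a +_) (proj₂ counts a∈cs) ⟨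
          walkCount cs (suc n) a a + walkCount cs n a a
        ≡⟨ walkCount-step counts a∈cs a∈cs ⟩
          walks≡ q n + suc q * walks≢ q n
        ∎)

  altSum : ℤ → ℕ → ℤ
  altSum Z p = foldr ℤ._+_ (ℤ.+ 0) (map (λ i → (ℤ.- (ℤ.+ 1)) ℤ.^ i ℤ.* Z ℤ.^ (p ∸ i)) (upTo (suc p)))

  ∑ℤ : List ℤ → ℤ
  ∑ℤ = foldr ℤ._+_ (ℤ.+ 0)

  ∑ℤ-negate : ∀ (F G : ℕ → ℤ) → (∀ i → F i ≡ ℤ.- G i) → ∀ n →
              ∑ℤ (applyUpTo F n) ≡ ℤ.- ∑ℤ (applyUpTo G n)
  ∑ℤ-negate F G F≗-G zero    = refl
  ∑ℤ-negate F G F≗-G (suc n) = begin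
      F 0 ℤ.+ ∑ℤ (applyUpTo (λ i → F (suc i)) n)
    ≡⟨ cong₂ ℤ._+_ (F≗-G 0) (∑ℤ-negate (λ i → F (suc i)) (λ i → G (suc i)) (λ i → F≗-G (suc i)) n) ⟩
      ℤ.- G 0 ℤ.+ ℤ.- ∑ℤ (applyUpTo (λ i → G (suc i)) n)
    ≡⟨ ℤP.neg-distrib-+ (G 0) _ ⟨
      ℤ.- ∑ℤ (applyUpTo G (suc n))
    ∎
    where open ≡-Reasoning

  altSum-suc : ∀ Z p → altSum Z (suc p) ≡ Z ℤ.^ suc p ℤ.- altSum Z p
  altSum-suc Z p = begin
      altSum Z (suc p)
    ≡⟨ cong (ℤ._+_ (term (suc p) 0)) (cong ∑ℤ (ListP.map-applyUpTo suc (term (suc p)) (suc p))) ⟩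
      term (suc p) 0 ℤ.+ ∑ℤ (applyUpTo (λ i → term (suc p) (suc i)) (suc p))
    ≡⟨ cong₂ ℤ._+_ (ℤP.*-identityˡ (Z ℤ.^ suc p))
                 (∑ℤ-negate (λ i → term (suc p) (suc i)) (term p) term-suc (suc p)) ⟩
      Z ℤ.^ suc p ℤ.- ∑ℤ (applyUpTo (term p) (suc p))
    ≡⟨ cong (λ xs → Z ℤ.^ suc p ℤ.- ∑ℤ xs) (ListP.map-applyUpTo (λ i → i) (term p) (suc p))  ⟨
      Z ℤ.^ suc p ℤ.- altSum Z p
    ∎
    where
    open ≡-Reasoning
    term : ℕ → ℕ → ℤ
    term r i = (ℤ.- (ℤ.+ 1)) ℤ.^ i ℤ.* Z ℤ.^ (r ∸ i)
    term-suc : ∀ i → term (suc p) (suc i) ≡ ℤ.- term p i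
    term-suc i = trans (cong (ℤ._* Z ℤ.^ (p ∸ i)) (ℤP.-1*i≡-i ((ℤ.- (ℤ.+ 1)) ℤ.^ i)))
                       (sym (ℤP.neg-distribˡ-* ((ℤ.- (ℤ.+ 1)) ℤ.^ i) (Z ℤ.^ (p ∸ i))))

  pos-^ : ∀ a n → ℤ.+ (a ^ n) ≡ (ℤ.+ a) ℤ.^ n
  pos-^ a zero    = refl
  pos-^ a (suc n) = trans (ℤP.pos-* a (a ^ n)) (cong (ℤ.+ a ℤ.*_) (pos-^ a n))

  pos-subtract : ∀ x y → ℤ.+ x ≡ ℤ.+ (x + y) ℤ.- ℤ.+ y
  pos-subtract x y = begin
      ℤ.+ x
    ≡⟨ cong ℤ.+_ (m+n∸n≡m x y) ⟨
      ℤ.+ (x + y ∸ y)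
    ≡⟨ ℤP.⊖-≥ (m≤n+m y x) ⟨
      (x + y) ℤ.⊖ y
    ≡⟨ ℤP.m-n≡m⊖n (x + y) y ⟨
      ℤ.+ (x + y) ℤ.- ℤ.+ y
    ∎
    where open ≡-Reasoning

  walks≢-closedForm : ∀ q n → ℤ.+ walks≢ q n ≡ altSum (ℤ.+ suc q) n
  walks≢-closedForm q zero    = refl
  walks≢-closedForm q (suc n) = begin
      ℤ.+ walks≢ q (suc n)
    ≡⟨ pos-subtract (walks≢ q (suc n)) (walks≢ q n) ⟩
      ℤ.+ (walks≢ q (suc n) + walks≢ q n) ℤ.- ℤ.+ walks≢ q n
    ≡⟨ cong (λ t → ℤ.+ t ℤ.- ℤ.+ walks≢ q n) (trans (walks≢-recurrence q n) (walks-total q n)) ⟩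
      ℤ.+ (suc q ^ suc n) ℤ.- ℤ.+ walks≢ q n
    ≡⟨ cong₂ ℤ._-_ (pos-^ (suc q) (suc n)) (walks≢-closedForm q n) ⟩
      (ℤ.+ suc q) ℤ.^ suc n ℤ.- altSum (ℤ.+ suc q) n
    ≡⟨ altSum-suc (ℤ.+ suc q) n ⟨
      altSum (ℤ.+ suc q) (suc n)
    ∎
    where open ≡-Reasoning

  All-concatMap-allFin : {A : Set} {P : A → Set} (n : ℕ) (f : Fin n → List A) →
                         All P (concatMap f (allFin n)) ⇔ (∀ l → All P (f l))
  All-concatMap-allFin n f =
    mk⇔ (λ ps → AllP.tabulate⁻ (AllP.map⁻ (AllP.concat⁻ ps)))
        (λ ps → AllP.concat⁺ (AllP.map⁺ (AllP.tabulate⁺ ps)))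

  positiveEdge⇔ : ∀ {N} (c : Vec ℤ N) (x y : Fin N) →
                  ProperEdge c (x , y , pos) ⇔ (¬ lookup c y ≡ lookup c x)
  positiveEdge⇔ c x y =
    mk⇔ (λ c≢ c≡ → c≢ (trans c≡ (sym (ℤP.*-identityˡ _))))
        (λ c≢ c≡ → c≢ (trans c≡ (ℤP.*-identityˡ _)))

  -- Paths ending in a fixed vertex v whose edges are produced by a labelling
  -- `positive` of vertex pairs by the sign +1 (stated for any such labelling so
  -- that it applies to the one used inside the definition of Book).
  module PositivePaths {N : ℕ} (c : Vec ℤ N) (v : Fin N)
                       (positive : Fin N × Fin N → Fin N × Fin N × Sign)
                       (positive-spec : ∀ x y → positive (x , y) ≡ (x , y , pos)) where

    positivePath⇔ : ∀ x xs → All (ProperEdge c) (map positive (pairs (x ∷ xs ++ v ∷ [])))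
                             ⇔ Walk (lookup c x) (map (lookup c) xs) (lookup c v)
    positivePath⇔ x [] rewrite positive-spec x v =
      mk⇔ (λ { (e ∷ []) → to (positiveEdge⇔ c x v) e })
          (λ w → from (positiveEdge⇔ c x v) w ∷ [])
    positivePath⇔ x (y ∷ xs) rewrite positive-spec x y =
      mk⇔ (λ { (e ∷ es) → to (positiveEdge⇔ c x y) e , to (positivePath⇔ y xs) es })
          (λ { (w , ws) → from (positiveEdge⇔ c x y) w ∷ from (positivePath⇔ y xs) ws })

    page⇔ : ∀ u x xs s → All (ProperEdge c) ((u , x , s) ∷ map positive (pairs (x ∷ xs ++ v ∷ [])))
                         ⇔ Walk (⟦ s ⟧ ℤ.* lookup c u) (map (lookup c) (x ∷ xs)) (lookup c v)
    page⇔ u x xs s =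
      mk⇔ (λ { (e ∷ es) → e , to (positivePath⇔ x xs) es })
          (λ { (e , w) → e ∷ from (positivePath⇔ x xs) w })

  pageSign : ℕ → {n : ℕ} → Fin n → Sign
  pageSign t l = if toℕ l <ᵇ t then neg else pos

  pageColours : ∀ {n p} → Vec ℤ (n * p) → Fin n → List ℤ
  pageColours r l = tabulate (λ j → lookup r (combine l j))

  PagesProper : ∀ n p → (Fin n → Sign) → ℤ → ℤ → Vec ℤ (n * p) → Set
  PagesProper n p s a b r = ∀ l → Walk (⟦ s l ⟧ ℤ.* a) (pageColours {n} {p} r l) b

  pagesProper? : ∀ n p s a b r → Dec (PagesProper n p s a b r)
  pagesProper? n p s a b r = FinP.all? (λ l → walk? (⟦ s l ⟧ ℤ.* a) (pageColours {n} {p} r l) b)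

  Book-proper⇔ : ∀ t m' n a b (r : Vec ℤ (n * suc m')) →
                 Proper (Book t (3 + m') n) (a ∷ b ∷ r) ⇔ (¬ b ≡ a × PagesProper n (suc m') (pageSign t) a b r)
  Book-proper⇔ t m' n a b r =
    mk⇔ (λ { (e ∷ es) → to spine e , λ l → subst (λ xs → Walk (⟦ pageSign t l ⟧ ℤ.* a) xs b) (colours l)
                              (to (page⇔ zero _ _ (pageSign t l)) (to (All-concatMap-allFin n _) es l)) })
        (λ { (e , ps) → from spine e ∷ from (All-concatMap-allFin n _) (λ l →
              from (page⇔ zero _ _ (pageSign t l))
                   (subst (λ xs → Walk (⟦ pageSign t l ⟧ ℤ.* a) xs b) (sym (colours l)) (ps l))) })
    where
    c : Vec ℤ (2 + n * suc m')
    c = a ∷ b ∷ r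
    open PositivePaths c (suc zero) _ (λ x y → refl)
    spine : ProperEdge c (zero , suc zero , pos) ⇔ (¬ b ≡ a)
    spine = positiveEdge⇔ c zero (suc zero)
    colours : ∀ l → map (lookup c) (map (λ j → 2 ↑ʳ combine l j) (allFin (suc m'))) ≡ pageColours {n} {suc m'} r l
    colours l = trans (sym (ListP.map-∘ (allFin (suc m')))) (ListP.map-tabulate (λ j → j) _)

  module PageCount (cs : List ℤ) (p : ℕ) where

    pageCount : (n : ℕ) → (Fin n → Sign) → ℤ → ℤ → ℕ
    pageCount n s a b = ∑[ r ← allVecs cs (n * p) ] 𝟙 (pagesProper? n p s a b r)

    pages-split : ∀ n s a b (v : Vec ℤ p) (w : Vec ℤ (n * p)) →
                  PagesProper (suc n) p s a b (v Vec.++ w)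
                  ⇔ (Walk (⟦ s zero ⟧ ℤ.* a) (tabulate (lookup v)) b × PagesProper n p (λ l → s (suc l)) a b w)
    pages-split n s a b v w =
      mk⇔ (λ ps → subst (λ xs → Walk _ xs b) first (ps zero) ,
                  λ l → subst (λ xs → Walk _ xs b) (rest l) (ps (suc l)))
          (λ { (p₀ , ps) zero    → subst (λ xs → Walk _ xs b) (sym first) p₀
             ; (p₀ , ps) (suc l) → subst (λ xs → Walk _ xs b) (sym (rest l)) (ps l) })
      where
      first : pageColours {suc n} {p} (v Vec.++ w) zero ≡ tabulate (lookup v)
      first = ListP.tabulate-cong (VecP.lookup-++ˡ v w)
      rest : ∀ l → pageColours {suc n} {p} (v Vec.++ w) (suc l) ≡ pageColours {n} {p} w l
      rest l = ListP.tabulate-cong (λ j → VecP.lookup-++ʳ v w _)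

    pageCount-zero : ∀ s a b → pageCount zero s a b ≡ 1
    pageCount-zero s a b with pagesProper? zero p s a b []
    ... | yes _  = refl
    ... | no ¬ps = ⊥-elim (¬ps (λ ()))

    pageCount-suc : ∀ n s a b →
                    pageCount (suc n) s a b ≡ walkCount cs p (⟦ s zero ⟧ ℤ.* a) b * pageCount n (λ l → s (suc l)) a b
    pageCount-suc n s a b = begin
        pageCount (suc n) s a b
      ≡⟨ ∑-allVecs-++ cs p (n * p) _ ⟩
        ∑[ v ← allVecs cs p ] ∑[ w ← allVecs cs (n * p) ] 𝟙 (pagesProper? (suc n) p s a b (v Vec.++ w))
      ≡⟨ ∑-cong (allVecs cs p) (λ v → ∑-cong (allVecs cs (n * p)) (λ w → trans
           (𝟙-⇔ (pages-split n s a b v w) _ (first? v ×-dec rest? w)) (𝟙-× (first? v) (rest? w)))) ⟩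
        ∑[ v ← allVecs cs p ] ∑[ w ← allVecs cs (n * p) ] 𝟙 (first? v) * 𝟙 (rest? w)
      ≡⟨ ∑-cong (allVecs cs p) (λ v → ∑-*ˡ (𝟙 (first? v)) (λ w → 𝟙 (rest? w)) (allVecs cs (n * p))) ⟩
        ∑[ v ← allVecs cs p ] 𝟙 (first? v) * pageCount n (λ l → s (suc l)) a b
      ≡⟨ ∑-*ʳ (pageCount n (λ l → s (suc l)) a b) (λ v → 𝟙 (first? v)) (allVecs cs p) ⟩
        walkCount cs p (⟦ s zero ⟧ ℤ.* a) b * pageCount n (λ l → s (suc l)) a b
      ∎
      where
      open ≡-Reasoning
      first? : (v : Vec ℤ p) → Dec (Walk (⟦ s zero ⟧ ℤ.* a) (tabulate (lookup v)) b)
      first? v = walk? (⟦ s zero ⟧ ℤ.* a) (tabulate (lookup v)) b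
      rest? : (w : Vec ℤ (n * p)) → Dec (PagesProper n p (λ l → s (suc l)) a b w)
      rest? w = pagesProper? n p (λ l → s (suc l)) a b w

    pageCount-uniform : ∀ n s a b → pageCount n (λ _ → s) a b ≡ walkCount cs p (⟦ s ⟧ ℤ.* a) b ^ n
    pageCount-uniform zero    s a b = pageCount-zero (λ _ → s) a b
    pageCount-uniform (suc n) s a b =
      trans (pageCount-suc n (λ _ → s) a b) (cong (walkCount cs p (⟦ s ⟧ ℤ.* a) b *_) (pageCount-uniform n s a b))

  χb-Book : ∀ t m' n k →
            χb (Book t (3 + m') n) k
            ≡ ∑[ a ← colors k ] ∑[ b ← colors k ] 𝟙 (¬? (b ℤ.≟ a)) * PageCount.pageCount (colors k) (suc m') n (pageSign t) a b
  χb-Book t m' n k = begin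
      χb (Book t (3 + m') n) k
    ≡⟨ length-filter (proper? G) (allVecs cs (2 + n * p)) ⟩
      ∑[ c ← allVecs cs (2 + n * p) ] 𝟙 (proper? G c)
    ≡⟨ ∑-allVecs-suc cs (suc (n * p)) _ ⟩
      ∑[ a ← cs ] ∑[ c ← allVecs cs (suc (n * p)) ] 𝟙 (proper? G (a ∷ c))
    ≡⟨ ∑-cong cs (λ a → ∑-allVecs-suc cs (n * p) _) ⟩
      ∑[ a ← cs ] ∑[ b ← cs ] ∑[ r ← allVecs cs (n * p) ] 𝟙 (proper? G (a ∷ b ∷ r))
    ≡⟨ ∑-cong cs (λ a → ∑-cong cs (λ b → spine-and-pages a b)) ⟩
      ∑[ a ← cs ] ∑[ b ← cs ] 𝟙 (¬? (b ℤ.≟ a)) * PageCount.pageCount cs p n (pageSign t) a b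
    ∎
    where
    open ≡-Reasoning
    G : SignedGraph
    G = Book t (3 + m') n
    cs : List ℤ
    cs = colors k
    p : ℕ
    p = suc m'
    spine-and-pages : ∀ a b → ∑[ r ← allVecs cs (n * p) ] 𝟙 (proper? G (a ∷ b ∷ r))
                              ≡ 𝟙 (¬? (b ℤ.≟ a)) * PageCount.pageCount cs p n (pageSign t) a b
    spine-and-pages a b = trans
      (∑-cong (allVecs cs (n * p)) (λ r → trans
        (𝟙-⇔ (Book-proper⇔ t m' n a b r) _ (¬? (b ℤ.≟ a) ×-dec pagesProper? n p (pageSign t) a b r))
        (𝟙-× (¬? (b ℤ.≟ a)) (pagesProper? n p (pageSign t) a b r))))
      (∑-*ˡ (𝟙 (¬? (b ℤ.≟ a))) _ (allVecs cs (n * p)))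

  colors-unique : ∀ k → Unique (colors k)
  colors-unique k = UniqueP.++⁺ (UniqueP.map⁺ ℤP.neg-injective positive-unique) positive-unique disjoint
    where
    positive-unique : Unique (posColors k)
    positive-unique = UniqueP.map⁺ (λ eq → suc-injective (ℤP.+-injective eq)) (UniqueP.upTo⁺ k)
    disjoint : ∀ {x} → x ∈ map ℤ.-_ (posColors k) × x ∈ posColors k → ⊥
    disjoint (x∈neg , x∈pos) with ∈-map⁻ ℤ.-_ x∈neg | ∈-map⁻ (λ i → ℤ.+ suc i) x∈pos
    ... | y , y∈pos , refl | _ , _ , -y≡+j with ∈-map⁻ (λ i → ℤ.+ suc i) y∈pos
    ... | _ , _ , refl with -y≡+j
    ... | ()

  colors-length : ∀ k' → length (colors (suc k')) ≡ suc (suc (k' + k'))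
  colors-length k' = begin
      length (map ℤ.-_ (posColors (suc k')) ++ posColors (suc k'))
    ≡⟨ ListP.length-++ (map ℤ.-_ (posColors (suc k'))) ⟩
      length (map ℤ.-_ (posColors (suc k'))) + length (posColors (suc k'))
    ≡⟨ cong₂ _+_ (trans (ListP.length-map ℤ.-_ (posColors (suc k'))) k-positive) k-positive ⟩
      suc k' + suc k'
    ≡⟨ cong suc (+-suc k' k') ⟩
      suc (suc (k' + k'))
    ∎
    where
    open ≡-Reasoning
    k-positive : length (posColors (suc k')) ≡ suc k'
    k-positive = trans (ListP.length-map (λ i → ℤ.+ suc i) (upTo (suc k'))) (ListP.length-upTo (suc k'))

  module BookWithOneNegativePage (m' k' : ℕ) where
    private
      cs : List ℤ
      cs = colors (suc k')
      q p : ℕ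
      q = k' + k'
      p = suc m'
    open CompleteGraphWalks cs q (colors-unique (suc k')) (colors-length k')
    open PageCount cs p

    pageFactor : ℕ
    pageFactor = walks≢ q p

    spineCount : ℕ
    spineCount = ∑[ a ← cs ] ∑[ b ← cs ] 𝟙 (¬? (b ℤ.≟ a)) * walkCount cs p (⟦ neg ⟧ ℤ.* a) b

    positivePage : ∀ {a b} → a ∈ cs → b ∈ cs → ¬ b ≡ a → walkCount cs p (⟦ pos ⟧ ℤ.* a) b ≡ pageFactor
    positivePage {a} {b} a∈cs b∈cs b≢a =
      trans (cong (λ a′ → walkCount cs p a′ b) (ℤP.*-identityˡ a))
            (proj₁ (walkCounts p) a∈cs b∈cs (λ a≡b → b≢a (sym a≡b)))

    χb-Book₁ : ∀ n → χb (Book 1 (3 + m') (suc n)) (suc k') ≡ spineCount * pageFactor ^ n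
    χb-Book₁ n = begin
        χb (Book 1 (3 + m') (suc n)) (suc k')
      ≡⟨ χb-Book 1 m' (suc n) (suc k') ⟩
        ∑[ a ← cs ] ∑[ b ← cs ] 𝟙 (¬? (b ℤ.≟ a)) * pageCount (suc n) (pageSign 1) a b
      ≡⟨ ∑-cong∈ cs (λ a a∈cs → ∑-cong∈ cs (λ b b∈cs → spine-and-pages a∈cs b∈cs)) ⟩
        ∑[ a ← cs ] ∑[ b ← cs ] 𝟙 (¬? (b ℤ.≟ a)) * walkCount cs p (⟦ neg ⟧ ℤ.* a) b * pageFactor ^ n
      ≡⟨ ∑-cong cs (λ a → ∑-*ʳ (pageFactor ^ n) (λ b → 𝟙 (¬? (b ℤ.≟ a)) * walkCount cs p (⟦ neg ⟧ ℤ.* a) b) cs) ⟩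
        ∑[ a ← cs ] (∑[ b ← cs ] 𝟙 (¬? (b ℤ.≟ a)) * walkCount cs p (⟦ neg ⟧ ℤ.* a) b) * pageFactor ^ n
      ≡⟨ ∑-*ʳ (pageFactor ^ n) (λ a → ∑[ b ← cs ] 𝟙 (¬? (b ℤ.≟ a)) * walkCount cs p (⟦ neg ⟧ ℤ.* a) b) cs ⟩
        spineCount * pageFactor ^ n
      ∎
      where
      open ≡-Reasoning
      pages : ∀ {a b} → a ∈ cs → b ∈ cs → ¬ b ≡ a →
              pageCount (suc n) (pageSign 1) a b ≡ walkCount cs p (⟦ neg ⟧ ℤ.* a) b * pageFactor ^ n
      pages {a} {b} a∈cs b∈cs b≢a =
        trans (pageCount-suc n (pageSign 1) a b)
              (cong (walkCount cs p (⟦ neg ⟧ ℤ.* a) b *_)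
                    (trans (pageCount-uniform n pos a b) (cong (_^ n) (positivePage a∈cs b∈cs b≢a))))
      spine-and-pages : ∀ {a b} → a ∈ cs → b ∈ cs →
                        𝟙 (¬? (b ℤ.≟ a)) * pageCount (suc n) (pageSign 1) a b
                        ≡ 𝟙 (¬? (b ℤ.≟ a)) * walkCount cs p (⟦ neg ⟧ ℤ.* a) b * pageFactor ^ n
      spine-and-pages {a} {b} a∈cs b∈cs with b ℤ.≟ a
      ... | yes _   = refl
      ... | no b≢a  = trans (cong (1 *_) (pages a∈cs b∈cs b≢a))
                            (sym (*-assoc 1 (walkCount cs p (⟦ neg ⟧ ℤ.* a) b) (pageFactor ^ n)))

    χb-Book₁-recurrence : ∀ n → χb (Book 1 (3 + m') (2 + n)) (suc k')
                                ≡ pageFactor * χb (Book 1 (3 + m') (suc n)) (suc k')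
    χb-Book₁-recurrence n = begin
        χb (Book 1 (3 + m') (2 + n)) (suc k')
      ≡⟨ χb-Book₁ (suc n) ⟩
        spineCount * (pageFactor * pageFactor ^ n)
      ≡⟨ swap spineCount pageFactor (pageFactor ^ n) ⟩
        pageFactor * (spineCount * pageFactor ^ n)
      ≡⟨ cong (pageFactor *_) (χb-Book₁ n) ⟨
        pageFactor * χb (Book 1 (3 + m') (suc n)) (suc k')
      ∎
      where
      open ≡-Reasoning
      swap : ∀ x y z → x * (y * z) ≡ y * (x * z)
      swap = solve-∀

    pageFactor-closedForm : ℤ.+ pageFactor ≡ bookFactor (3 + m') (suc k')
    pageFactor-closedForm = trans (walks≢-closedForm q p) (cong (λ Z → altSum Z p) (sym two-k-minus-one))
      where
      two-k-minus-one : ℤ.+ (2 * suc k') ℤ.- ℤ.+ 1 ≡ ℤ.+ suc q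
      two-k-minus-one = cong ℤ.+_ (trans (cong (k' +_) (+-identityʳ (suc k'))) (+-suc k' k'))

open import Defs
import Data.Nat as ℕ
open import Data.Nat using (ℕ; _≤_; _∸_; zero; suc; s≤s)
open import Data.Integer using (+_; _*_)
open import Data.Integer.Properties using (pos-*)
open import Relation.Binary.PropositionalEquality using (_≡_; cong; module ≡-Reasoning)
open BookColourings using (module BookWithOneNegativePage)

theorem7p6 : (m n k : ℕ) → 3 ≤ m → 2 ≤ n → 1 ≤ k →
    + χb (Book 1 m n) k ≡ bookFactor m k * + χb (Book 1 m (n ∸ 1)) k
theorem7p6 m@(suc (suc (suc m'))) n@(suc (suc n')) k@(suc k') _ _ _ = begin
    + χb (Book 1 m n) k
  ≡⟨ cong +_ (χb-Book₁-recurrence n') ⟩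
    + (pageFactor ℕ.* χb (Book 1 m (n ∸ 1)) k)
  ≡⟨ pos-* pageFactor _ ⟩
    + pageFactor * + χb (Book 1 m (n ∸ 1)) k
  ≡⟨ cong (_* + χb (Book 1 m (n ∸ 1)) k) pageFactor-closedForm ⟩
    bookFactor m k * + χb (Book 1 m (n ∸ 1)) k
  ∎
  where
  open BookWithOneNegativePage m' k'
  open ≡-Reasoning
theorem7p6 (suc (suc (suc m'))) (suc zero) _ _ (s≤s ()) _
theorem7p6 (suc (suc (suc m'))) (suc (suc n)) zero _ _ ()
theorem7p6 (suc (suc zero)) _ _ (s≤s (s≤s ())) _ _
theorem7p6 (suc zero) _ _ (s≤s ()) _ _
theorem7p6 zero _ _ () _ _
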